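{- In $\mathsf{CnCK}_R$: $\mathbin{\Box\!\!\to}$ is fully hyperconnexive; $\mathbin{\Box\!\!\Rightarrow}$ is fully connexive but neither weakly nor plainly hyperconnexive; $\mathbin{\Diamond\!\!\to}$ is weakly partially hyperconnexive but neither weakly nor plainly connexive; and $\mathbin{\Diamond\!\!\Rightarrow}$ is weakly partially connexive but neither weakly nor plainly connexive, nor weakly partially hyperconnexive.
   Context: Conditional formulas are built from propositional letters with $\wedge,\vee,\to$, $\sim$ (strong negation), binary $\mathbin{\Box\!\!\to}$, $\mathbin{\Diamond\!\!\to}$. Defined: $\phi\mathbin{\Box\!\!\Rightarrow}\psi:=(\phi\mathbin{\Box\!\!\to}\psi)\wedge(\sim\psi\mathbin{\Box\!\!\to}\sim\phi)$; $\phi\mathbin{\Diamond\!\!\Rightarrow}\psi:=(\phi\mathbin{\Diamond\!\!\to}\psi)\wedge(\sim\psi\mathbin{\Diamond\!\!\to}\sim\phi)$. A conditional Fischer-Servi model is $(W,\leq,R,V^+,V^-)$, $W\neq\emptyset$, $\leq$ a preorder, $R\subseteq W\times(\mathcal{P}(W))^2\times W$, $V^\pm$ maps letters to $\leq$-upward closed sets, such that for all $X,Y$, $R_{(X,Y)}=\{(w,v)\mid R(w,(X,Y),v)\}$ satisfies (c1) $w\leq w'$, $wR_{(X,Y)}v$ imply $w'R_{(X,Y)}v'$, $v\leq v'$ for some $v'$; (c2) $wR_{(X,Y)}v$, $v\leq v'$ imply $w\leq w'$, $w'R_{(X,Y)}v'$ for some $w'$; it is reflexive if $R(w,(X,Y),v)$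 implies $v\in X$. Satisfaction: $w\models^\pm p$ iff $w\in V^\pm(p)$; $\wedge$: $+$ iff both $+$, $-$ iff some $-$; $\vee$: $+$ iff some $+$, $-$ iff both $-$; $w\models^\pm\sim\psi$ iff $w\models^\mp\psi$; $w\models^+\psi\to\chi$ iff $\forall v\geq w(v\models^+\psi\Rightarrow v\models^+\chi)$; $w\models^-\psi\to\chi$ iff $\forall v\geq w(v\models^+\psi\Rightarrow v\models^-\chi)$; with $\|\psi\|=(\{w\mid w\models^+\psi\},\{w\mid w\models^-\psi\})$: $w\models^\pm\psi\mathbin{\Box\!\!\to}\chi$ iff $\forall v\geq w\,\forall u(vR_{\|\psi\|}u\Rightarrow u\models^\pm\chi)$; $w\models^\pm\psi\mathbin{\Diamond\!\!\to}\chi$ iff $\exists u(wR_{\|\psi\|}u$ and $u\models^\pm\chi)$. $\Gamma\models_{\mathsf{CnCK}_R}\Delta$ iff no world of any reflexive model verifies ($\models^+$) all of $\Gamma$ and none of $\Delta$; $\phi\in\mathsf{CnCK}_R$ iff $\emptyset\models\{\phi\}$. For a logic $\mathsf{L}$ and binary $\ast$, schemes: (AT) $\sim(\sim\phi\ast\phi)$; (BT) $(\phi\ast\sim\psi)\ast\sim(\phi\ast\psi)$; (nonSym) $(\phi\ast\psi)\ast(\psi\ast\phi)$; (WBT) $\phi\ast\sim\psi\models_\mathsf{L}\sim(\phi\ast\psi)$; (WnonSym) $\phi\ast\psi\models_\mathsf{L}\psi\ast\phi$; (CBT) $\sim(\phi\ast\psi)\ast(\phi\ast\sim\psi)$; (WCBT)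 $\sim(\phi\ast\psi)\models_\mathsf{L}\phi\ast\sim\psi$. Plainly connexive: all AT, BT instances valid and some nonSym instance not; weakly connexive: all AT, WBT hold and some WnonSym fails; fully connexive: both. Plainly (weakly) hyperconnexive: plainly (weakly) connexive plus all CBT (WCBT) instances; fully hyperconnexive: both. Weakly partially connexive: all WBT hold and some WnonSym fails; weakly partially hyperconnexive: weakly partially connexive plus all WCBT. -}

module Defs where

open import Data.Nat using (ℕ)
open import Data.Product using (Σ; ∃; _×_; _,_)
open import Data.List using (List; []; _∷_)
open import Data.List.Relation.Unary.All using (All)
open import Data.Empty using (⊥)
open import Data.Sum using (_⊎_)
open import Relation.Nullary using (¬_)

infixr 30 ∼_
infixr 25 _∧_ _∨_
infixr 20 _⇒_ _□→_ _◇→_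

data Fm : Set where
  var  : ℕ → Fm
  _∧_  : Fm → Fm → Fm
  _∨_  : Fm → Fm → Fm
  _⇒_  : Fm → Fm → Fm        -- intuitionistic implication →
  ∼_   : Fm → Fm
  _□→_ : Fm → Fm → Fm
  _◇→_ : Fm → Fm → Fm

_□⇒_ : Fm → Fm → Fm
φ □⇒ ψ = (φ □→ ψ) ∧ (∼ ψ □→ ∼ φ)

_◇⇒_ : Fm → Fm → Fm
φ ◇⇒ ψ = (φ ◇→ ψ) ∧ (∼ ψ ◇→ ∼ φ)

-- Subsets of W are predicates W → Set; R takes a pair (X , Y) of subsets.
-- Since R is a relation on *sets*, we require it to respect extensional
-- equality of subsets (so that it is a function of the sets themselves).

_≐_ : {W : Set} → (W → Set) → (W → Set) → Set
X ≐ Y = ∀ w → (X w → Y w) × (Y w → X w)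

record Model : Set₁ where
  field
    W       : Set
    inhabited : W
    _≤_     : W → W → Set
    ≤-refl  : ∀ w → w ≤ w
    ≤-trans : ∀ {u v w} → u ≤ v → v ≤ w → u ≤ w
    R       : (W → Set) → (W → Set) → W → W → Set
    R-ext   : ∀ {X X' Y Y' w v} → X ≐ X' → Y ≐ Y' → R X Y w v → R X' Y' w v
    V⁺      : ℕ → W → Set
    V⁻      : ℕ → W → Set
    V⁺-up   : ∀ p {w w'} → w ≤ w' → V⁺ p w → V⁺ p w'
    V⁻-up   : ∀ p {w w'} → w ≤ w' → V⁻ p w → V⁻ p w'
    c1 : ∀ X Y {w w' v} → w ≤ w' → R X Y w v → Σ W λ v' → R X Y w' v' × v ≤ v'
    c2 : ∀ X Y {w v v'} → R X Y w v → v ≤ v' → Σ W λ w' → w ≤ w' × R X Y w' v'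

Reflexive : Model → Set₁
Reflexive M = ∀ X Y w v → R X Y w v → X v
  where open Model M

data Pol : Set where
  pos neg : Pol

flip : Pol → Pol
flip pos = neg
flip neg = pos

module _ (M : Model) where
  open Model M

  sat : Pol → Fm → W → Set
  sat pos (var p) w = V⁺ p w
  sat neg (var p) w = V⁻ p w
  sat pos (φ ∧ ψ) w = sat pos φ w × sat pos ψ w
  sat neg (φ ∧ ψ) w = sat neg φ w ⊎ sat neg ψ w
  sat pos (φ ∨ ψ) w = sat pos φ w ⊎ sat pos ψ w
  sat neg (φ ∨ ψ) w = sat neg φ w × sat neg ψ w
  sat pos (φ ⇒ ψ) w = ∀ v → w ≤ v → sat pos φ v → sat pos ψ v
  sat neg (φ ⇒ ψ) w = ∀ v → w ≤ v → sat pos φ v → sat neg ψ v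
  sat s   (∼ φ) w = sat (flip s) φ w
  sat s   (φ □→ ψ) w =
    ∀ v → w ≤ v → ∀ u → R (sat pos φ) (sat neg φ) v u → sat s ψ u
  sat s   (φ ◇→ ψ) w =
    Σ W λ u → R (sat pos φ) (sat neg φ) w u × sat s ψ u

_⊨_ : List Fm → List Fm → Set₁
Γ ⊨ Δ = ∀ (M : Model) → Reflexive M → ∀ (w : Model.W M) →
        All (λ φ → sat M pos φ w) Γ → All (λ δ → ¬ sat M pos δ w) Δ → ⊥

Valid : Fm → Set₁
Valid φ = [] ⊨ (φ ∷ [])

Conn : Set
Conn = Fm → Fm → Fm

module _ (_∗_ : Conn) where
  AT : Set₁
  AT = ∀ φ → Valid (∼ (∼ φ ∗ φ))

  BT : Set₁
  BT = ∀ φ ψ → Valid ((φ ∗ ∼ ψ) ∗ ∼ (φ ∗ ψ))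

  SomeNonSymFails : Set₁
  SomeNonSymFails = Σ Fm λ φ → Σ Fm λ ψ → ¬ Valid ((φ ∗ ψ) ∗ (ψ ∗ φ))

  WBT : Set₁
  WBT = ∀ φ ψ → ((φ ∗ ∼ ψ) ∷ []) ⊨ (∼ (φ ∗ ψ) ∷ [])

  SomeWNonSymFails : Set₁
  SomeWNonSymFails = Σ Fm λ φ → Σ Fm λ ψ → ¬ (((φ ∗ ψ) ∷ []) ⊨ ((ψ ∗ φ) ∷ []))

  CBT : Set₁
  CBT = ∀ φ ψ → Valid (∼ (φ ∗ ψ) ∗ (φ ∗ ∼ ψ))

  WCBT : Set₁
  WCBT = ∀ φ ψ → (∼ (φ ∗ ψ) ∷ []) ⊨ ((φ ∗ ∼ ψ) ∷ [])

  PlainlyConnexive : Set₁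
  PlainlyConnexive = AT × BT × SomeNonSymFails

  WeaklyConnexive : Set₁
  WeaklyConnexive = AT × WBT × SomeWNonSymFails

  FullyConnexive : Set₁
  FullyConnexive = PlainlyConnexive × WeaklyConnexive

  PlainlyHyperconnexive : Set₁
  PlainlyHyperconnexive = PlainlyConnexive × CBT

  WeaklyHyperconnexive : Set₁
  WeaklyHyperconnexive = WeaklyConnexive × WCBT

  FullyHyperconnexive : Set₁
  FullyHyperconnexive = PlainlyHyperconnexive × WeaklyHyperconnexive

  WeaklyPartiallyConnexive : Set₁
  WeaklyPartiallyConnexive = WBT × SomeWNonSymFails

  WeaklyPartiallyHyperconnexive : Set₁
  WeaklyPartiallyHyperconnexive = WeaklyPartiallyConnexive × WCBT

{-# OPTIONS --safe #-}
module Submission where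

open import Defs
open import Data.Bool using (Bool; true; false)
open import Data.Empty using (⊥)
open import Data.List using ([]; _∷_)
open import Data.List.Relation.Unary.All using ([]; _∷_)
open import Data.Nat using (ℕ)
open import Data.Product using (_×_; _,_; proj₁; proj₂)
open import Data.Sum using (inj₁; [_,_])
open import Data.Unit using (⊤; tt)
open import Function using (id; _∘_)
open import Relation.Binary.PropositionalEquality using (_≡_; refl; trans)
open import Relation.Nullary using (¬_)

-- For ∗ ∈ {□→, ◇→} the clauses of sat make  sat M s (φ ∗ ∼ ψ)  and
-- sat M (flip s) (φ ∗ ψ)  definitionally equal, so φ ∗ ∼ ψ and ∼ (φ ∗ ψ) are
-- interchangeable.  This gives WBT and WCBT, and with reflexivity (every
-- R‖φ‖-successor verifies φ) also AT, BT and CBT for □→.  The contrapositive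
-- conjunct of □⇒ and ◇⇒ is what breaks (W)CBT, and a ◇-conditional fails AT at
-- a world from which no world verifying its antecedent is accessible.

Verified : Fm → Set₁
Verified φ = ∀ M → Reflexive M → ∀ w → sat M pos φ w

_⊩_ : Fm → Fm → Set₁
φ ⊩ ψ = ∀ M → Reflexive M → ∀ w → sat M pos φ w → sat M pos ψ w

verified⇒valid : ∀ {φ} → Verified φ → Valid φ
verified⇒valid ⊢φ M reflexive w [] (⊭φ ∷ []) = ⊭φ (⊢φ M reflexive w)

⊩⇒⊨ : ∀ {φ ψ} → φ ⊩ ψ → (φ ∷ []) ⊨ (ψ ∷ [])
⊩⇒⊨ φ⊩ψ M reflexive w (⊢φ ∷ []) (⊭ψ ∷ []) = ⊭ψ (φ⊩ψ M reflexive w ⊢φ)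

module _ (M : Model) (reflexive : Reflexive M) (w : Model.W M) where

  ¬valid : ∀ {φ} → ¬ sat M pos φ w → ¬ Valid φ
  ¬valid ⊭φ valid = valid M reflexive w [] (⊭φ ∷ [])

  ¬⊨ : ∀ {φ ψ} → sat M pos φ w → ¬ sat M pos ψ w → ¬ ((φ ∷ []) ⊨ (ψ ∷ []))
  ¬⊨ ⊢φ ⊭ψ φ⊨ψ = φ⊨ψ M reflexive w (⊢φ ∷ []) (⊭ψ ∷ [])

module _ (M : Model) where
  open Model M

  □→-intro : Reflexive M → ∀ s φ ψ {w} →
             (∀ u → sat M pos φ u → sat M s ψ u) → sat M s (φ □→ ψ) w
  □→-intro reflexive pos _ _ φ→ψ v _ u vRu = φ→ψ u (reflexive _ _ v u vRu)
  □→-intro reflexive neg _ _ φ→ψ v _ u vRu = φ→ψ u (reflexive _ _ v u vRu)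

  □→-elim : ∀ {φ ψ w u} → R (sat M pos φ) (sat M neg φ) w u →
            sat M pos (φ □→ ψ) w → sat M pos ψ u
  □→-elim {w = w} {u} wRu ⊢φ□→ψ = ⊢φ□→ψ w (≤-refl w) u wRu

withContrapositive : Conn → Conn
withContrapositive _∗_ φ ψ = (φ ∗ ψ) ∧ (∼ ψ ∗ ∼ φ)

AT-withContrapositive : ∀ _∗_ → AT _∗_ → AT (withContrapositive _∗_)
AT-withContrapositive _ at φ M reflexive w [] (⊭∼ ∷ []) =
  at φ M reflexive w [] ((⊭∼ ∘ inj₁) ∷ [])

WBT-withContrapositive : ∀ _∗_ → WBT _∗_ → WBT (withContrapositive _∗_)
WBT-withContrapositive _ wbt φ ψ M reflexive w (⊢φ∗∼ψ ∷ []) (⊭∼ ∷ []) =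
  wbt φ ψ M reflexive w (proj₁ ⊢φ∗∼ψ ∷ []) ((⊭∼ ∘ inj₁) ∷ [])

AT-□→ : AT _□→_
AT-□→ φ = verified⇒valid λ M reflexive _ →
  □→-intro M reflexive neg (∼ φ) φ (λ _ → id)

BT-□→ : BT _□→_
BT-□→ φ ψ = verified⇒valid λ M reflexive _ →
  □→-intro M reflexive pos (φ □→ ∼ ψ) (∼ (φ □→ ψ)) (λ _ → id)

CBT-□→ : CBT _□→_
CBT-□→ φ ψ = verified⇒valid λ M reflexive _ →
  □→-intro M reflexive pos (∼ (φ □→ ψ)) (φ □→ ∼ ψ) (λ _ → id)

WBT-□→ : WBT _□→_
WBT-□→ φ ψ = ⊩⇒⊨ λ _ _ _ → id

WCBT-□→ : WCBT _□→_
WCBT-□→ φ ψ = ⊩⇒⊨ λ _ _ _ → id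

AT-□⇒ : AT _□⇒_
AT-□⇒ = AT-withContrapositive _□→_ AT-□→

BT-□⇒ : BT _□⇒_
BT-□⇒ φ ψ = verified⇒valid λ M reflexive _ →
  □→-intro M reflexive pos (φ □⇒ ∼ ψ) (∼ (φ □⇒ ψ)) (λ _ → inj₁ ∘ proj₁) ,
  □→-intro M reflexive pos (∼ ∼ (φ □⇒ ψ)) (∼ (φ □⇒ ∼ ψ)) (λ _ → inj₁ ∘ proj₁)

WBT-□⇒ : WBT _□⇒_
WBT-□⇒ = WBT-withContrapositive _□→_ WBT-□→

WBT-◇→ : WBT _◇→_
WBT-◇→ φ ψ = ⊩⇒⊨ λ _ _ _ → id

WCBT-◇→ : WCBT _◇→_
WCBT-◇→ φ ψ = ⊩⇒⊨ λ _ _ _ → id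

WBT-◇⇒ : WBT _◇⇒_
WBT-◇⇒ = WBT-withContrapositive _◇→_ WBT-◇→

data Belnap : Set where
  gap T F glut : Belnap

Verifies : Belnap → Set
Verifies T    = ⊤
Verifies glut = ⊤
Verifies _    = ⊥

Falsifies : Belnap → Set
Falsifies F    = ⊤
Falsifies glut = ⊤
Falsifies _    = ⊥

discrete : (W : Set) → W → (Acc : (W → Set) → (W → Set) → W → Set) →
           (∀ {X X' Y Y'} → X ≐ X' → Y ≐ Y' → ∀ {v} → Acc X Y v → Acc X' Y' v) →
           (ℕ → W → Belnap) → Model
discrete W w₀ Acc Acc-ext val = record
  { W = W ; inhabited = w₀
  ; _≤_ = _≡_ ; ≤-refl = λ _ → refl ; ≤-trans = trans
  ; R = λ X Y _ v → Acc X Y v ; R-ext = λ X≐X' Y≐Y' → Acc-ext X≐X' Y≐Y'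
  ; V⁺ = λ n w → Verifies (val n w) ; V⁻ = λ n w → Falsifies (val n w)
  ; V⁺-up = λ { _ refl x → x } ; V⁻-up = λ { _ refl x → x }
  ; c1 = λ { _ _ {v = v} refl wRv → v , wRv , refl }
  ; c2 = λ { _ _ {w = w} wRv refl → w , refl , wRv } }

p q r : Fm
p = var 0
q = var 1
r = var 2

oneWorld : Model
oneWorld = discrete ⊤ tt (λ X _ v → X v) (λ X≐X' _ {v} → proj₁ (X≐X' v)) val
  where
  val : ℕ → ⊤ → Belnap
  val 0 _ = gap
  val 1 _ = T
  val _ _ = F

oneWorld-reflexive : Reflexive oneWorld
oneWorld-reflexive _ _ _ _ = id

-- Only worlds where the antecedent is verified but not falsified are
-- accessible; this breaks the symmetry that would make ◇→ commutative.
twoWorld : Model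
twoWorld = discrete Bool true (λ X Y v → X v × ¬ Y v)
  (λ X≐X' Y≐Y' {v} (x , ¬y) → proj₁ (X≐X' v) x , ¬y ∘ proj₂ (Y≐Y' v)) val
  where
  val : ℕ → Bool → Belnap
  val 0 true  = T
  val 0 false = glut
  val 1 true  = glut
  val 1 false = F
  val _ _     = gap

twoWorld-reflexive : Reflexive twoWorld
twoWorld-reflexive _ _ _ _ = proj₁

p□→q : sat oneWorld pos (p □→ q) tt
p□→q _ _ _ ()

¬q□→p : ¬ sat oneWorld pos (q □→ p) tt
¬q□→p = □→-elim oneWorld {q} {p} tt

p□⇒q : sat oneWorld pos (p □⇒ q) tt
p□⇒q = p□→q , λ _ _ _ ()

¬q□⇒p : ¬ sat oneWorld pos (q □⇒ p) tt
¬q□⇒p = ¬q□→p ∘ proj₁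

∼p□⇒q : sat oneWorld pos (∼ (p □⇒ q)) tt
∼p□⇒q = inj₁ λ _ _ _ ()

¬p□⇒∼q : ¬ sat oneWorld pos (p □⇒ ∼ q) tt
¬p□⇒∼q = □→-elim oneWorld {∼ ∼ q} {∼ p} tt ∘ proj₂

SomeNonSymFails-□→ : SomeNonSymFails _□→_
SomeNonSymFails-□→ = p , q , ¬valid oneWorld oneWorld-reflexive tt
  (¬q□→p ∘ □→-elim oneWorld {p □→ q} {q □→ p} p□→q)

SomeWNonSymFails-□→ : SomeWNonSymFails _□→_
SomeWNonSymFails-□→ = p , q , ¬⊨ oneWorld oneWorld-reflexive tt p□→q ¬q□→p

SomeNonSymFails-□⇒ : SomeNonSymFails _□⇒_
SomeNonSymFails-□⇒ = p , q , ¬valid oneWorld oneWorld-reflexive tt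
  (¬q□⇒p ∘ □→-elim oneWorld {p □⇒ q} {q □⇒ p} p□⇒q ∘ proj₁)

SomeWNonSymFails-□⇒ : SomeWNonSymFails _□⇒_
SomeWNonSymFails-□⇒ = p , q , ¬⊨ oneWorld oneWorld-reflexive tt p□⇒q ¬q□⇒p

¬WCBT-□⇒ : ¬ WCBT _□⇒_
¬WCBT-□⇒ wcbt = ¬⊨ oneWorld oneWorld-reflexive tt ∼p□⇒q ¬p□⇒∼q (wcbt p q)

¬CBT-□⇒ : ¬ CBT _□⇒_
¬CBT-□⇒ cbt = ¬valid oneWorld oneWorld-reflexive tt
  (¬p□⇒∼q ∘ □→-elim oneWorld {∼ (p □⇒ q)} {p □⇒ ∼ q} ∼p□⇒q ∘ proj₁) (cbt p q)

¬∼p◇→ : ∀ s ψ → ¬ sat oneWorld s (∼ p ◇→ ψ) tt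
¬∼p◇→ pos _ (_ , () , _)
¬∼p◇→ neg _ (_ , () , _)

¬AT-◇→ : ¬ AT _◇→_
¬AT-◇→ at = ¬valid oneWorld oneWorld-reflexive tt (¬∼p◇→ neg p) (at p)

¬AT-◇⇒ : ¬ AT _◇⇒_
¬AT-◇⇒ at = ¬valid oneWorld oneWorld-reflexive tt
  [ ¬∼p◇→ neg p , ¬∼p◇→ neg (∼ ∼ p) ] (at p)

¬WCBT-◇⇒ : ¬ WCBT _◇⇒_
¬WCBT-◇⇒ wcbt =
  ¬⊨ oneWorld oneWorld-reflexive tt (inj₁ (tt , tt , tt)) ¬q◇⇒∼r (wcbt q r)
  where
  ¬q◇⇒∼r : ¬ sat oneWorld pos (q ◇⇒ ∼ r) tt
  ¬q◇⇒∼r (_ , _ , () , _)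

p◇→q : sat twoWorld pos (p ◇→ q) true
p◇→q = true , (tt , λ ()) , tt

¬q◇→p : ¬ sat twoWorld pos (q ◇→ p) true
¬q◇→p (true  , (_ , q-unfalsified) , _) = q-unfalsified tt
¬q◇→p (false , (() , _) , _)

SomeWNonSymFails-◇→ : SomeWNonSymFails _◇→_
SomeWNonSymFails-◇→ = p , q , ¬⊨ twoWorld twoWorld-reflexive true p◇→q ¬q◇→p

SomeWNonSymFails-◇⇒ : SomeWNonSymFails _◇⇒_
SomeWNonSymFails-◇⇒ = p , q , ¬⊨ twoWorld twoWorld-reflexive true
  (p◇→q , false , (tt , λ ()) , tt) (¬q◇→p ∘ proj₁)

proposition6p6 :
    FullyHyperconnexive _□→_
    × (FullyConnexive _□⇒_ × ¬ WeaklyHyperconnexive _□⇒_ × ¬ PlainlyHyperconnexive _□⇒_)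
    × (WeaklyPartiallyHyperconnexive _◇→_ × ¬ WeaklyConnexive _◇→_ × ¬ PlainlyConnexive _◇→_)
    × (WeaklyPartiallyConnexive _◇⇒_ × ¬ WeaklyConnexive _◇⇒_ × ¬ PlainlyConnexive _◇⇒_
       × ¬ WeaklyPartiallyHyperconnexive _◇⇒_)
proposition6p6 =
  ( ((AT-□→ , BT-□→ , SomeNonSymFails-□→) , CBT-□→)
  , ((AT-□→ , WBT-□→ , SomeWNonSymFails-□→) , WCBT-□→) )
  , ( ( (AT-□⇒ , BT-□⇒ , SomeNonSymFails-□⇒)
      , (AT-□⇒ , WBT-□⇒ , SomeWNonSymFails-□⇒) )
    , ¬WCBT-□⇒ ∘ proj₂ , ¬CBT-□⇒ ∘ proj₂ )
  , ( ((WBT-◇→ , SomeWNonSymFails-◇→) , WCBT-◇→)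
    , ¬AT-◇→ ∘ proj₁ , ¬AT-◇→ ∘ proj₁ )
  , ( (WBT-◇⇒ , SomeWNonSymFails-◇⇒)
    , ¬AT-◇⇒ ∘ proj₁ , ¬AT-◇⇒ ∘ proj₁ , ¬WCBT-◇⇒ ∘ proj₂ )
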